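{- Each rule of $\mathsf{IDiLL}$ is admissible in $\mathsf{DB}_{\mathcal{D}}\mathsf{LL}$, and each rule of $\mathsf{DB}_{\mathcal{D}}\mathsf{LL}$ except the non-indexed dereliction $\mathsf{d}$ and codereliction $\bar{\mathsf{d}}$ is admissible in $\mathsf{IDiLL}$.
   Context: $\mathcal{D}$ is the set of linear partial differential operators with constant coefficients (LPDOcc) on functions $\mathbb{R}^n\to\mathbb{R}$; under composition $\circ$ with unit $id$ it is a commutative additive splitting monoid (whenever $D_1\circ D_2=D_3\circ D_4$ there are $D_{1,3},D_{1,4},D_{2,3},D_{2,4}$ with $D_1=D_{1,3}\circ D_{1,4}$, $D_2=D_{2,3}\circ D_{2,4}$, $D_3=D_{1,3}\circ D_{2,3}$, $D_4=D_{1,4}\circ D_{2,4}$). $\mathsf{IDiLL}$ has formulas $A,B := 0 \mid 1 \mid \top \mid \bot \mid A \otimes B \mid A ⅋ B \mid A \,\&\, B \mid A \oplus B$ and $E,F := ?_D A \mid !_D A \mid E \otimes F \mid E ⅋ F \mid E \,\&\, F \mid E \oplus F$ ($D\in\mathcal{D}$), MALL rules, and exponential rules (one-sided): $\mathsf{w}_I$: from $\vdash\Gamma$ infer $\vdash\Gamma,?_D A$; $\mathsf{c}$: from $\vdash\Gamma,?_{D_1}A,?_{D_2}A$ infer $\vdash\Gamma,?_{D_1\circ D_2}A$; $\mathsf{d}_I$: from $\vdash\Gamma,?_{D_1}A$ infer $\vdash\Gamma,?_{D_1\circ D_2}A$; $\bar{\mathsf{w}}_I$: $\vdash !_D A$;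 $\bar{\mathsf{c}}$: from $\vdash\Gamma,!_{D_1}A$ and $\vdash\Delta,!_{D_2}A$ infer $\vdash\Gamma,\Delta,!_{D_1\circ D_2}A$; $\bar{\mathsf{d}}_I$: from $\vdash\Gamma,!_{D_1}A$ infer $\vdash\Gamma,!_{D_1\circ D_2}A$. $\mathsf{DB}_{\mathcal{D}}\mathsf{LL}$ is the logic $\mathsf{DBSLL}$ (differential graded linear logic without promotion, over a monoid $(\mathcal{S},+,0)$) instantiated with $\mathcal{S}=(\mathcal{D},\circ,id)$: formulas are MALL formulas together with $?A,!A,?_xA,!_xA$, and exponential rules: $\mathsf{w}$: from $\vdash\Gamma$ infer $\vdash\Gamma,?_0A$; $\mathsf{c}$: from $\vdash\Gamma,?_xA,?_yA$ infer $\vdash\Gamma,?_{x+y}A$; $\mathsf{d}_I$: from $\vdash\Gamma,?_xA$ and $x\le y$ infer $\vdash\Gamma,?_yA$; $\mathsf{d}$: from $\vdash\Gamma,A$ infer $\vdash\Gamma,?A$; $\bar{\mathsf{w}}$: $\vdash !_0A$; $\bar{\mathsf{c}}$: from $\vdash\Gamma,!_xA$ and $\vdash\Delta,!_yA$ infer $\vdash\Gamma,\Delta,!_{x+y}A$; $\bar{\mathsf{d}}_I$: from $\vdash\Gamma,!_xA$ and $x\le y$ infer $\vdash\Gamma,!_yA$; $\bar{\mathsf{d}}$: from $\vdash\Gamma,A$ infer $\vdash\Gamma,!A$. The preorder is $x\le y$ iff $\exists x',\ x+x'=y$, i.e. here $D_1\le D_2$ iff $\exists D_3,\ D_2=D_1\circ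 D_3$; the unit $0$ is $id$. -}

module Defs where

open import Data.List using (List; []; _∷_; _++_; map; [_])
open import Data.List.Relation.Binary.Permutation.Propositional using (_↭_)
open import Data.List.Relation.Unary.All using (All)
open import Data.Product using (Σ; ∃; _,_; _×_)
open import Data.Unit using (⊤)
open import Data.Empty using (⊥)
open import Algebra.Structures using (IsCommutativeMonoid)
open import Relation.Binary.PropositionalEquality using (_≡_)

-- Commutative (additively written) splitting monoid, with propositional
-- equality.  This abstracts the monoid (𝒟, ∘, id) of LPDOcc.

record SplittingMonoid : Set₁ where
  infixl 7 _∙_
  field
    Carrier : Set
    _∙_     : Carrier → Carrier → Carrier
    ε       : Carrier
    isCommutativeMonoid : IsCommutativeMonoid _≡_ _∙_ ε
    splitting : ∀ x₁ x₂ x₃ x₄ → x₁ ∙ x₂ ≡ x₃ ∙ x₄ →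
      Σ Carrier λ x₁₃ → Σ Carrier λ x₁₄ → Σ Carrier λ x₂₃ → Σ Carrier λ x₂₄ →
        (x₁ ≡ x₁₃ ∙ x₁₄) × (x₂ ≡ x₂₃ ∙ x₂₄) × (x₃ ≡ x₁₃ ∙ x₂₃) × (x₄ ≡ x₁₄ ∙ x₂₄)

  _≤_ : Carrier → Carrier → Set
  x ≤ y = Σ Carrier λ x' → x ∙ x' ≡ y

data Derivable {Seq : Set} (R : List Seq → Seq → Set) : Seq → Set where
  by : ∀ {ps c} → R ps c → All (Derivable R) ps → Derivable R c

module Logics (M : SplittingMonoid) where
  open SplittingMonoid M

  infixl 6 _⊗_ _⅋_ _&_ _⊕_

  data Form : Set where
    𝟎 𝟏 ⊤ₗ ⊥ₗ : Form
    _⊗_ _⅋_ _&_ _⊕_ : Form → Form → Form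
    ¿_ ¡_ : Form → Form
    ¿[_]_ ¡[_]_ : Carrier → Form → Form

  _⊥' : Form → Form
  𝟎 ⊥' = ⊤ₗ
  𝟏 ⊥' = ⊥ₗ
  ⊤ₗ ⊥' = 𝟎
  ⊥ₗ ⊥' = 𝟏
  (A ⊗ B) ⊥' = (A ⊥') ⅋ (B ⊥')
  (A ⅋ B) ⊥' = (A ⊥') ⊗ (B ⊥')
  (A & B) ⊥' = (A ⊥') ⊕ (B ⊥')
  (A ⊕ B) ⊥' = (A ⊥') & (B ⊥')
  (¿ A) ⊥' = ¡ (A ⊥')
  (¡ A) ⊥' = ¿ (A ⊥')
  (¿[ x ] A) ⊥' = ¡[ x ] (A ⊥')
  (¡[ x ] A) ⊥' = ¿[ x ] (A ⊥')

  Seq : Set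
  Seq = List Form

  data DBRule : List Seq → Seq → Set where
    ax   : ∀ A → DBRule [] ((A ⊥') ∷ A ∷ [])
    cut  : ∀ A Γ Δ → DBRule ((A ∷ Γ) ∷ ((A ⊥') ∷ Δ) ∷ []) (Γ ++ Δ)
    ex   : ∀ Γ Δ → Γ ↭ Δ → DBRule (Γ ∷ []) Δ
    one  : DBRule [] (𝟏 ∷ [])
    bot  : ∀ Γ → DBRule (Γ ∷ []) (⊥ₗ ∷ Γ)
    top  : ∀ Γ → DBRule [] (⊤ₗ ∷ Γ)
    tens : ∀ A B Γ Δ → DBRule ((A ∷ Γ) ∷ (B ∷ Δ) ∷ []) ((A ⊗ B) ∷ Γ ++ Δ)
    par  : ∀ A B Γ → DBRule ((A ∷ B ∷ Γ) ∷ []) ((A ⅋ B) ∷ Γ)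
    with' : ∀ A B Γ → DBRule ((A ∷ Γ) ∷ (B ∷ Γ) ∷ []) ((A & B) ∷ Γ)
    plus₁ : ∀ A B Γ → DBRule ((A ∷ Γ) ∷ []) ((A ⊕ B) ∷ Γ)
    plus₂ : ∀ A B Γ → DBRule ((B ∷ Γ) ∷ []) ((A ⊕ B) ∷ Γ)
    w    : ∀ A Γ → DBRule (Γ ∷ []) (¿[ ε ] A ∷ Γ)
    c    : ∀ x y A Γ → DBRule ((¿[ x ] A ∷ ¿[ y ] A ∷ Γ) ∷ []) (¿[ x ∙ y ] A ∷ Γ)
    dI   : ∀ x y A Γ → x ≤ y → DBRule ((¿[ x ] A ∷ Γ) ∷ []) (¿[ y ] A ∷ Γ)
    d    : ∀ A Γ → DBRule ((A ∷ Γ) ∷ []) (¿ A ∷ Γ)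
    w̄    : ∀ A → DBRule [] (¡[ ε ] A ∷ [])
    c̄    : ∀ x y A Γ Δ → DBRule ((¡[ x ] A ∷ Γ) ∷ (¡[ y ] A ∷ Δ) ∷ []) (¡[ x ∙ y ] A ∷ Γ ++ Δ)
    d̄I   : ∀ x y A Γ → x ≤ y → DBRule ((¡[ x ] A ∷ Γ) ∷ []) (¡[ y ] A ∷ Γ)
    d̄    : ∀ A Γ → DBRule ((A ∷ Γ) ∷ []) (¡ A ∷ Γ)

  NotDer : ∀ {ps c} → DBRule ps c → Set
  NotDer (d _ _) = ⊥
  NotDer (d̄ _ _) = ⊥
  NotDer _ = ⊤

  DB⊢_ : Seq → Set
  DB⊢ Γ = Derivable DBRule Γ

  -- IDiLL: two-sorted syntax (sort mall : formulas A, sort expo : formulas E)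

  data Sort : Set where
    mall expo : Sort

  data IF : Sort → Set where
    𝟎 𝟏 ⊤ₗ ⊥ₗ : IF mall
    _⊗_ _⅋_ _&_ _⊕_ : ∀ {s} → IF s → IF s → IF s
    ¿[_]_ ¡[_]_ : Carrier → IF mall → IF expo

  _⊥ᴵ : ∀ {s} → IF s → IF s
  𝟎 ⊥ᴵ = ⊤ₗ
  𝟏 ⊥ᴵ = ⊥ₗ
  ⊤ₗ ⊥ᴵ = 𝟎
  ⊥ₗ ⊥ᴵ = 𝟏
  (A ⊗ B) ⊥ᴵ = (A ⊥ᴵ) ⅋ (B ⊥ᴵ)
  (A ⅋ B) ⊥ᴵ = (A ⊥ᴵ) ⊗ (B ⊥ᴵ)
  (A & B) ⊥ᴵ = (A ⊥ᴵ) ⊕ (B ⊥ᴵ)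
  (A ⊕ B) ⊥ᴵ = (A ⊥ᴵ) & (B ⊥ᴵ)
  (¿[ x ] A) ⊥ᴵ = ¡[ x ] (A ⊥ᴵ)
  (¡[ x ] A) ⊥ᴵ = ¿[ x ] (A ⊥ᴵ)

  IFormula : Set
  IFormula = Σ Sort IF

  ⟪_⟫ : ∀ {s} → IF s → IFormula
  ⟪_⟫ {s} A = s , A

  ISeq : Set
  ISeq = List IFormula

  data IRule : List ISeq → ISeq → Set where
    ax   : ∀ {s} (A : IF s) → IRule [] (⟪ A ⊥ᴵ ⟫ ∷ ⟪ A ⟫ ∷ [])
    cut  : ∀ {s} (A : IF s) Γ Δ → IRule ((⟪ A ⟫ ∷ Γ) ∷ (⟪ A ⊥ᴵ ⟫ ∷ Δ) ∷ []) (Γ ++ Δ)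
    ex   : ∀ Γ Δ → Γ ↭ Δ → IRule (Γ ∷ []) Δ
    one  : IRule [] (⟪ 𝟏 ⟫ ∷ [])
    bot  : ∀ Γ → IRule (Γ ∷ []) (⟪ ⊥ₗ ⟫ ∷ Γ)
    top  : ∀ Γ → IRule [] (⟪ ⊤ₗ ⟫ ∷ Γ)
    tens : ∀ {s} (A B : IF s) Γ Δ → IRule ((⟪ A ⟫ ∷ Γ) ∷ (⟪ B ⟫ ∷ Δ) ∷ []) (⟪ A ⊗ B ⟫ ∷ Γ ++ Δ)
    par  : ∀ {s} (A B : IF s) Γ → IRule ((⟪ A ⟫ ∷ ⟪ B ⟫ ∷ Γ) ∷ []) (⟪ A ⅋ B ⟫ ∷ Γ)
    with' : ∀ {s} (A B : IF s) Γ → IRule ((⟪ A ⟫ ∷ Γ) ∷ (⟪ B ⟫ ∷ Γ) ∷ []) (⟪ A & B ⟫ ∷ Γ)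
    plus₁ : ∀ {s} (A B : IF s) Γ → IRule ((⟪ A ⟫ ∷ Γ) ∷ []) (⟪ A ⊕ B ⟫ ∷ Γ)
    plus₂ : ∀ {s} (A B : IF s) Γ → IRule ((⟪ B ⟫ ∷ Γ) ∷ []) (⟪ A ⊕ B ⟫ ∷ Γ)
    wI   : ∀ D A Γ → IRule (Γ ∷ []) (⟪ ¿[ D ] A ⟫ ∷ Γ)
    c    : ∀ D₁ D₂ A Γ → IRule ((⟪ ¿[ D₁ ] A ⟫ ∷ ⟪ ¿[ D₂ ] A ⟫ ∷ Γ) ∷ []) (⟪ ¿[ D₁ ∙ D₂ ] A ⟫ ∷ Γ)
    dI   : ∀ D₁ D₂ A Γ → IRule ((⟪ ¿[ D₁ ] A ⟫ ∷ Γ) ∷ []) (⟪ ¿[ D₁ ∙ D₂ ] A ⟫ ∷ Γ)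
    w̄I   : ∀ D A → IRule [] (⟪ ¡[ D ] A ⟫ ∷ [])
    c̄    : ∀ D₁ D₂ A Γ Δ → IRule ((⟪ ¡[ D₁ ] A ⟫ ∷ Γ) ∷ (⟪ ¡[ D₂ ] A ⟫ ∷ Δ) ∷ []) (⟪ ¡[ D₁ ∙ D₂ ] A ⟫ ∷ Γ ++ Δ)
    d̄I   : ∀ D₁ D₂ A Γ → IRule ((⟪ ¡[ D₁ ] A ⟫ ∷ Γ) ∷ []) (⟪ ¡[ D₁ ∙ D₂ ] A ⟫ ∷ Γ)

  I⊢_ : ISeq → Set
  I⊢ Γ = Derivable IRule Γ

  emb : ∀ {s} → IF s → Form
  emb 𝟎 = 𝟎
  emb 𝟏 = 𝟏
  emb ⊤ₗ = ⊤ₗ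
  emb ⊥ₗ = ⊥ₗ
  emb (A ⊗ B) = emb A ⊗ emb B
  emb (A ⅋ B) = emb A ⅋ emb B
  emb (A & B) = emb A & emb B
  emb (A ⊕ B) = emb A ⊕ emb B
  emb (¿[ x ] A) = ¿[ x ] emb A
  emb (¡[ x ] A) = ¡[ x ] emb A

  embSeq : ISeq → Seq
  embSeq = map (λ { (s , A) → emb A })

  IDiLL-admissible-in-DB : Set
  IDiLL-admissible-in-DB =
    ∀ {ps c} → IRule ps c → All (λ p → DB⊢ embSeq p) ps → DB⊢ embSeq c

  DB-admissible-in-IDiLL : Set
  DB-admissible-in-IDiLL =
    ∀ {ps c} (r : DBRule ps c) → NotDer r →
    (ps′ : List ISeq) (c′ : ISeq) → map embSeq ps′ ≡ ps → embSeq c′ ≡ c →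
    All I⊢_ ps′ → I⊢ c′

-- IDiLL formulas embed into DB_𝒟 LL formulas, and the embedding commutes with
-- duality.  Every IDiLL rule then becomes a DB_𝒟 LL rule on embedded sequents,
-- except that the indexed weakenings w_I and w̄_I, at an arbitrary D, are
-- obtained from w and w̄ at id followed by (co)dereliction from id ≤ D.
-- Conversely the embedding is injective and its graph is an inductive family,
-- so a DB_𝒟 LL rule instance between embedded sequents can be inverted by
-- pattern matching; unless it is d or d̄, it is then literally an IDiLL rule
-- instance.
module Submission where

open import Defs
open import Data.Product using (_×_; _,_; ∃)
open import Data.List using ([]; _∷_; map)
open import Data.List.Properties using (map-++)
open import Data.List.Relation.Unary.All using ([]; _∷_)
open import Data.List.Relation.Binary.Pointwise using (Pointwise; []; _∷_; ++⁺)
open import Data.List.Relation.Binary.Permutation.Propositional as Perm using (_↭_)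
open import Data.List.Relation.Binary.Permutation.Propositional.Properties using (map⁺)
open import Relation.Binary.PropositionalEquality using (_≡_; refl; sym; cong; cong₂; subst)
open import Algebra.Structures using (IsCommutativeMonoid)

module _ {A B : Set} {R : A → B → Set} where

  Pointwise-unique : (∀ {x y z} → R x z → R y z → x ≡ y) →
    ∀ {xs ys zs} → Pointwise R xs zs → Pointwise R ys zs → xs ≡ ys
  Pointwise-unique R-unique [] [] = refl
  Pointwise-unique R-unique (r ∷ rs) (s ∷ ss) =
    cong₂ _∷_ (R-unique r s) (Pointwise-unique R-unique rs ss)

  Pointwise-↭ : ∀ {xs ys zs} → Pointwise R xs ys → ys ↭ zs →
    ∃ λ ws → xs ↭ ws × Pointwise R ws zs
  Pointwise-↭ rs Perm.refl = _ , Perm.refl , rs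
  Pointwise-↭ (r ∷ rs) (Perm.prep _ π) with Pointwise-↭ rs π
  ... | _ , σ , ss = _ , Perm.prep _ σ , r ∷ ss
  Pointwise-↭ (r ∷ r′ ∷ rs) (Perm.swap _ _ π) with Pointwise-↭ rs π
  ... | _ , σ , ss = _ , Perm.swap _ _ σ , r′ ∷ r ∷ ss
  Pointwise-↭ rs (Perm.trans π ρ) with Pointwise-↭ rs π
  ... | _ , σ , ss with Pointwise-↭ ss ρ
  ... | _ , σ′ , ts = _ , Perm.trans σ σ′ , ts

module _ (M : SplittingMonoid) where
  open SplittingMonoid M
  open Logics M
  open IsCommutativeMonoid isCommutativeMonoid using (identityˡ)

  emb-⊥ : ∀ {s} (A : IF s) → emb (A ⊥ᴵ) ≡ emb A ⊥'
  emb-⊥ 𝟎 = refl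
  emb-⊥ 𝟏 = refl
  emb-⊥ ⊤ₗ = refl
  emb-⊥ ⊥ₗ = refl
  emb-⊥ (A ⊗ B) = cong₂ _⅋_ (emb-⊥ A) (emb-⊥ B)
  emb-⊥ (A ⅋ B) = cong₂ _⊗_ (emb-⊥ A) (emb-⊥ B)
  emb-⊥ (A & B) = cong₂ _⊕_ (emb-⊥ A) (emb-⊥ B)
  emb-⊥ (A ⊕ B) = cong₂ _&_ (emb-⊥ A) (emb-⊥ B)
  emb-⊥ (¿[ x ] A) = cong ¡[ x ]_ (emb-⊥ A)
  emb-⊥ (¡[ x ] A) = cong ¿[ x ]_ (emb-⊥ A)

  IDiLL-rule-admissible : IDiLL-admissible-in-DB
  IDiLL-rule-admissible (ax A) [] =
    subst (λ B → DB⊢ (B ∷ emb A ∷ [])) (sym (emb-⊥ A)) (by (ax _) [])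
  IDiLL-rule-admissible (cut A Γ Δ) (p ∷ q ∷ []) =
    subst DB⊢_ (sym (map-++ _ Γ Δ)) (by (cut _ _ _) (p ∷ subst (λ B → DB⊢ (B ∷ _)) (emb-⊥ A) q ∷ []))
  IDiLL-rule-admissible (ex _ _ π) (p ∷ []) = by (ex _ _ (map⁺ _ π)) (p ∷ [])
  IDiLL-rule-admissible one [] = by one []
  IDiLL-rule-admissible (bot _) (p ∷ []) = by (bot _) (p ∷ [])
  IDiLL-rule-admissible (top _) [] = by (top _) []
  IDiLL-rule-admissible (tens _ _ Γ Δ) (p ∷ q ∷ []) =
    subst (λ Θ → DB⊢ (_ ∷ Θ)) (sym (map-++ _ Γ Δ)) (by (tens _ _ _ _) (p ∷ q ∷ []))
  IDiLL-rule-admissible (par _ _ _) (p ∷ []) = by (par _ _ _) (p ∷ [])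
  IDiLL-rule-admissible (with' _ _ _) (p ∷ q ∷ []) = by (with' _ _ _) (p ∷ q ∷ [])
  IDiLL-rule-admissible (plus₁ _ _ _) (p ∷ []) = by (plus₁ _ _ _) (p ∷ [])
  IDiLL-rule-admissible (plus₂ _ _ _) (p ∷ []) = by (plus₂ _ _ _) (p ∷ [])
  IDiLL-rule-admissible (wI D _ _) (p ∷ []) =
    by (dI ε D _ _ (D , identityˡ D)) (by (w _ _) (p ∷ []) ∷ [])
  IDiLL-rule-admissible (c _ _ _ _) (p ∷ []) = by (c _ _ _ _) (p ∷ [])
  IDiLL-rule-admissible (dI _ D₂ _ _) (p ∷ []) = by (dI _ _ _ _ (D₂ , refl)) (p ∷ [])
  IDiLL-rule-admissible (w̄I D _) [] = by (d̄I ε D _ _ (D , identityˡ D)) (by (w̄ _) [] ∷ [])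
  IDiLL-rule-admissible (c̄ _ _ _ Γ Δ) (p ∷ q ∷ []) =
    subst (λ Θ → DB⊢ (_ ∷ Θ)) (sym (map-++ _ Γ Δ)) (by (c̄ _ _ _ _ _) (p ∷ q ∷ []))
  IDiLL-rule-admissible (d̄I _ D₂ _ _) (p ∷ []) = by (d̄I _ _ _ _ (D₂ , refl)) (p ∷ [])

  -- The graph of emb, as an inductive family: matching on  p ↦ A ⊗ B  inverts emb.
  infix 4 _↦_ _⇛_

  data _↦_ : IFormula → Form → Set where
    𝟎 : (mall , 𝟎) ↦ 𝟎
    𝟏 : (mall , 𝟏) ↦ 𝟏
    ⊤ₗ : (mall , ⊤ₗ) ↦ ⊤ₗ
    ⊥ₗ : (mall , ⊥ₗ) ↦ ⊥ₗ
    _⊗_ : ∀ {s X Y A B} → (s , X) ↦ A → (s , Y) ↦ B → (s , X ⊗ Y) ↦ A ⊗ B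
    _⅋_ : ∀ {s X Y A B} → (s , X) ↦ A → (s , Y) ↦ B → (s , X ⅋ Y) ↦ A ⅋ B
    _&_ : ∀ {s X Y A B} → (s , X) ↦ A → (s , Y) ↦ B → (s , X & Y) ↦ A & B
    _⊕_ : ∀ {s X Y A B} → (s , X) ↦ A → (s , Y) ↦ B → (s , X ⊕ Y) ↦ A ⊕ B
    ¿[_]_ : ∀ x {X A} → (mall , X) ↦ A → (expo , ¿[ x ] X) ↦ ¿[ x ] A
    ¡[_]_ : ∀ x {X A} → (mall , X) ↦ A → (expo , ¡[ x ] X) ↦ ¡[ x ] A

  _⇛_ : ISeq → Seq → Set
  _⇛_ = Pointwise _↦_

  ↦-emb : ∀ {s} (X : IF s) → ⟪ X ⟫ ↦ emb X
  ↦-emb 𝟎 = 𝟎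
  ↦-emb 𝟏 = 𝟏
  ↦-emb ⊤ₗ = ⊤ₗ
  ↦-emb ⊥ₗ = ⊥ₗ
  ↦-emb (X ⊗ Y) = ↦-emb X ⊗ ↦-emb Y
  ↦-emb (X ⅋ Y) = ↦-emb X ⅋ ↦-emb Y
  ↦-emb (X & Y) = ↦-emb X & ↦-emb Y
  ↦-emb (X ⊕ Y) = ↦-emb X ⊕ ↦-emb Y
  ↦-emb (¿[ x ] X) = ¿[ x ] ↦-emb X
  ↦-emb (¡[ x ] X) = ¡[ x ] ↦-emb X

  ⇛-embSeq : ∀ Γ → Γ ⇛ embSeq Γ
  ⇛-embSeq [] = []
  ⇛-embSeq ((s , X) ∷ Γ) = ↦-emb X ∷ ⇛-embSeq Γ

  ⇛-embSeqs : ∀ ps → Pointwise _⇛_ ps (map embSeq ps)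
  ⇛-embSeqs [] = []
  ⇛-embSeqs (Γ ∷ ps) = ⇛-embSeq Γ ∷ ⇛-embSeqs ps

  ↦-⊥ : ∀ {s} {X : IF s} {A} → ⟪ X ⟫ ↦ A → ⟪ X ⊥ᴵ ⟫ ↦ A ⊥'
  ↦-⊥ 𝟎 = ⊤ₗ
  ↦-⊥ 𝟏 = ⊥ₗ
  ↦-⊥ ⊤ₗ = 𝟎
  ↦-⊥ ⊥ₗ = 𝟏
  ↦-⊥ (g ⊗ h) = ↦-⊥ g ⅋ ↦-⊥ h
  ↦-⊥ (g ⅋ h) = ↦-⊥ g ⊗ ↦-⊥ h
  ↦-⊥ (g & h) = ↦-⊥ g ⊕ ↦-⊥ h
  ↦-⊥ (g ⊕ h) = ↦-⊥ g & ↦-⊥ h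
  ↦-⊥ (¿[ x ] g) = ¡[ x ] ↦-⊥ g
  ↦-⊥ (¡[ x ] g) = ¿[ x ] ↦-⊥ g

  ↦-unique : ∀ {p q A} → p ↦ A → q ↦ A → p ≡ q
  ↦-unique 𝟎 𝟎 = refl
  ↦-unique 𝟏 𝟏 = refl
  ↦-unique ⊤ₗ ⊤ₗ = refl
  ↦-unique ⊥ₗ ⊥ₗ = refl
  ↦-unique (g ⊗ h) (g′ ⊗ h′) with ↦-unique g g′ | ↦-unique h h′
  ... | refl | refl = refl
  ↦-unique (g ⅋ h) (g′ ⅋ h′) with ↦-unique g g′ | ↦-unique h h′
  ... | refl | refl = refl
  ↦-unique (g & h) (g′ & h′) with ↦-unique g g′ | ↦-unique h h′
  ... | refl | refl = refl
  ↦-unique (g ⊕ h) (g′ ⊕ h′) with ↦-unique g g′ | ↦-unique h h′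
  ... | refl | refl = refl
  ↦-unique (¿[ x ] g) (¿[ x ] g′) with ↦-unique g g′
  ... | refl = refl
  ↦-unique (¡[ x ] g) (¡[ x ] g′) with ↦-unique g g′
  ... | refl = refl

  ⇛-unique : ∀ {Γ Γ′ Δ} → Γ ⇛ Δ → Γ′ ⇛ Δ → Γ ≡ Γ′
  ⇛-unique = Pointwise-unique ↦-unique

  ⇛-↭ : ∀ {Γ Γ′ Δ Δ′} → Γ ⇛ Δ → Γ′ ⇛ Δ′ → Δ ↭ Δ′ → Γ ↭ Γ′
  ⇛-↭ gs hs π with Pointwise-↭ gs π
  ... | _ , σ , ks with ⇛-unique ks hs
  ... | refl = σ

  lift-rule : ∀ {ps c ps′ c′} (r : DBRule ps c) → NotDer r →
    Pointwise _⇛_ ps′ ps → c′ ⇛ c → IRule ps′ c′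
  lift-rule (ax _) _ [] (g ∷ h ∷ []) with ↦-unique g (↦-⊥ h)
  ... | refl = ax _
  lift-rule (cut _ _ _) _ ((g ∷ gs) ∷ (h ∷ hs) ∷ []) ks
    with ↦-unique h (↦-⊥ g) | ⇛-unique (++⁺ gs hs) ks
  ... | refl | refl = cut _ _ _
  lift-rule (ex _ _ π) _ (gs ∷ []) hs = ex _ _ (⇛-↭ gs hs π)
  lift-rule one _ [] (𝟏 ∷ []) = one
  lift-rule (bot _) _ (gs ∷ []) (⊥ₗ ∷ hs) with ⇛-unique gs hs
  ... | refl = bot _
  lift-rule (top _) _ [] (⊤ₗ ∷ _) = top _
  lift-rule (tens _ _ _ _) _ ((g ∷ gs) ∷ (h ∷ hs) ∷ []) ((g′ ⊗ h′) ∷ ks)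
    with ↦-unique g g′ | ↦-unique h h′ | ⇛-unique (++⁺ gs hs) ks
  ... | refl | refl | refl = tens _ _ _ _
  lift-rule (par _ _ _) _ ((g ∷ h ∷ gs) ∷ []) ((g′ ⅋ h′) ∷ hs)
    with ↦-unique g g′ | ↦-unique h h′ | ⇛-unique gs hs
  ... | refl | refl | refl = par _ _ _
  lift-rule (with' _ _ _) _ ((g ∷ gs) ∷ (h ∷ hs) ∷ []) ((g′ & h′) ∷ ks)
    with ↦-unique g g′ | ↦-unique h h′ | ⇛-unique gs ks | ⇛-unique hs ks
  ... | refl | refl | refl | refl = with' _ _ _
  lift-rule (plus₁ _ _ _) _ ((g ∷ gs) ∷ []) ((g′ ⊕ _) ∷ hs)
    with ↦-unique g g′ | ⇛-unique gs hs
  ... | refl | refl = plus₁ _ _ _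
  lift-rule (plus₂ _ _ _) _ ((h ∷ gs) ∷ []) ((_ ⊕ h′) ∷ hs)
    with ↦-unique h h′ | ⇛-unique gs hs
  ... | refl | refl = plus₂ _ _ _
  lift-rule (w _ _) _ (gs ∷ []) ((¿[ _ ] _) ∷ hs) with ⇛-unique gs hs
  ... | refl = wI _ _ _
  lift-rule (c _ _ _ _) _ (((¿[ _ ] g) ∷ (¿[ _ ] h) ∷ gs) ∷ []) ((¿[ _ ] k) ∷ hs)
    with ↦-unique g k | ↦-unique h k | ⇛-unique gs hs
  ... | refl | refl | refl = c _ _ _ _
  lift-rule (dI x _ _ _ (z , refl)) _ (((¿[ _ ] g) ∷ gs) ∷ []) ((¿[ _ ] k) ∷ hs)
    with ↦-unique g k | ⇛-unique gs hs
  ... | refl | refl = dI x z _ _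
  lift-rule (w̄ _) _ [] ((¡[ _ ] _) ∷ []) = w̄I _ _
  lift-rule (c̄ _ _ _ _ _) _ (((¡[ _ ] g) ∷ gs) ∷ ((¡[ _ ] h) ∷ hs) ∷ []) ((¡[ _ ] k) ∷ ks)
    with ↦-unique g k | ↦-unique h k | ⇛-unique (++⁺ gs hs) ks
  ... | refl | refl | refl = c̄ _ _ _ _ _
  lift-rule (d̄I x _ _ _ (z , refl)) _ (((¡[ _ ] g) ∷ gs) ∷ []) ((¡[ _ ] k) ∷ hs)
    with ↦-unique g k | ⇛-unique gs hs
  ... | refl | refl = d̄I x z _ _
  lift-rule (d _ _) () _ _
  lift-rule (d̄ _ _) () _ _

  DB-rule-admissible : DB-admissible-in-IDiLL
  DB-rule-admissible r nd ps′ c′ refl refl ds =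
    by (lift-rule r nd (⇛-embSeqs ps′) (⇛-embSeq c′)) ds

proposition4p5 : (M : SplittingMonoid) →
    Logics.IDiLL-admissible-in-DB M × Logics.DB-admissible-in-IDiLL M
proposition4p5 M = IDiLL-rule-admissible M , DB-rule-admissible M
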